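{- Let $\mathsf{L}\in\{\mathsf{PFL},\mathsf{PQFL},\mathsf{NFL},\mathsf{NQFL},\mathsf{NQFL}^-\}$, let $\mathcal B$ be an open and fully expanded branch of a $\mathsf{TC}_\mathsf{L}$-tableau, let $\mathsf{TERM}(\mathcal B)$ be the set of all terms (parameters and definite descriptions) occurring on $\mathcal B$, and let $t_1\sim t_2$ mean that the formula $t_1=t_2$ occurs on $\mathcal B$ or $t_1$ is the same term as $t_2$. Then for any $t_1,t_2\in\mathsf{TERM}(\mathcal B)$ with $t_1\sim t_2$ and every formula $\varphi$: $\varphi[x/t_1]\in\mathcal B$ iff $\varphi[x/t_2]\in\mathcal B$.
   Context: Language. Terms: bound variables $x,y,\dots$, parameters $a,b,\dots$, and definite descriptions (DDs) $\imath x\varphi$; formulas: $P(t_1,\dots,t_n)$, $t_1=t_2$, $\mathtt{E}t$ (existence predicate; absent for $\mathsf{NQFL}^-$), $\neg\varphi$, $\varphi\wedge\psi$, $\forall x\varphi$. $\varphi[x/t]$ is correct substitution; $t_1\neq t_2$ abbreviates $\neg(t_1=t_2)$. Tableau rules (premises $\Rightarrow$ conclusions; "$\mid$" separates branches; $t,t_1,\dots$ terms present on the branch, $b,b_1,b_2$ parameters present on the branch, $a,a_i$ fresh parameters): $(\neg\neg E)$ $\neg\neg\varphi\Rightarrow\varphi$; $(\wedge E)$ $\varphi\wedge\psi\Rightarrow\varphi,\psi$; $(\neg\wedge E)$ $\neg(\varphi\wedge\psi)\Rightarrow\neg\varphi\mid\neg\psi$; $(\bot_1)$ $\varphi,\neg\varphi\Rightarrow\bot$;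 $(\bot_2)$ $t\neq t\Rightarrow\bot$; $(\bot_3)$ $b\neq b\Rightarrow\bot$; $(\forall E_1)$ $\forall x\varphi\Rightarrow\varphi[x/b]$; $(\neg\forall E_1)$ $\neg\forall x\varphi\Rightarrow\neg\varphi[x/a]$; $(\forall E_2)$ $\forall x\varphi,\mathtt{E}b\Rightarrow\varphi[x/b]$; $(\neg\forall E_2)$ $\neg\forall x\varphi\Rightarrow\mathtt{E}a,\neg\varphi[x/a]$; $(=E)$ $t_1\approx t_2,\varphi[x/t_1]\Rightarrow\varphi[x/t_2]$ ($t_1\approx t_2$ is $t_1=t_2$ or $t_2=t_1$); $(=I_1)$ $P(t_1,\dots,t_n)\Rightarrow a_i=t_i$ for $t_i$ a DD; $(=I_2)$ $t_1=t_2\Rightarrow a_i=t_i$ for $t_i$ a DD; $(cut_1)$ $\Rightarrow b=t\mid b\neq t$, $t$ a DD; $(cut_2)$ $\mathtt{E}b\Rightarrow b=t\mid b\neq t$, $t$ a DD; $(\mathtt{E}E_1)$ $\mathtt{E}t\Rightarrow a=t$, $t$ a DD; $(\mathtt{E}E_2)$ $\mathtt{E}t\Rightarrow t=t$; $(\mathtt{E}I_1)$ $P(t_1,\dots,t_n)\Rightarrow\mathtt{E}t_i$ (for $\mathsf{NFL}$ only $t_i$ a DD); $(\mathtt{E}I_2)$ $t_1=t_2\Rightarrow\mathtt{E}t_i$ (for $\mathsf{NFL}$ only $t_i$ a DD); $(\mathtt{E}I_3)$ $\Rightarrow\mathtt{E}b$; $(\mathtt{E}I_4)$ $\Rightarrow\mathtt{E}a$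 if no parameters on the branch; $(\imath E_1)$ $b_1=\imath x\varphi\Rightarrow\varphi[x/b_1],\neg\varphi[x/b_2]\mid b_1=b_2,\varphi[x/b_1]$; $(\neg\imath E_1)$ $b\neq\imath x\varphi\Rightarrow\neg\varphi[x/b]\mid a\neq b,\varphi[x/a]$; $(\imath E_2)$ $b_1=\imath x\varphi,\mathtt{E}b_1,\mathtt{E}b_2\Rightarrow$ same as $(\imath E_1)$; $(\neg\imath E_2)$ $b\neq\imath x\varphi,\mathtt{E}b\Rightarrow\neg\varphi[x/b]\mid a\neq b,\varphi[x/a],\mathtt{E}a$. Calculi: all contain $(\neg\neg E),(\wedge E),(\neg\wedge E),(\bot_1),(=E)$; additionally $\mathsf{TC}_\mathsf{PFL}$: $(\bot_2),(\forall E_2),(\neg\forall E_2),(cut_2),(\mathtt{E}E_1),(\imath E_2),(\neg\imath E_2)$; $\mathsf{TC}_\mathsf{PQFL}$: $(\bot_2),(\forall E_1),(\neg\forall E_1),(cut_2),(\mathtt{E}E_1),(\mathtt{E}I_3),(\imath E_1),(\neg\imath E_1)$; $\mathsf{TC}_\mathsf{NFL}$: $(\mathtt{E}E_2),(\forall E_2),(\neg\forall E_2),(cut_2),(\mathtt{E}E_1),(\mathtt{E}I_1),(\mathtt{E}I_2),(\imath E_2),(\neg\imath E_2)$; $\mathsf{TC}_\mathsf{NQFL}$: $(\bot_3),(\forall E_1),(\neg\forall E_1),(cut_2),(\mathtt{E}E_1),(\mathtt{E}I_1),(\mathtt{E}I_2),(\mathtt{E}I_3),(\imath E_1),(\neg\imath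 E_1)$; $\mathsf{TC}_{\mathsf{NQFL}^- }$: $(\bot_3),(\forall E_1),(\neg\forall E_1),(cut_1),(=I_1),(=I_2),(\imath E_1),(\neg\imath E_1)$; for $\mathsf{PFL},\mathsf{NFL}$ also $(\mathtt{E}I_4)$ under the non-empty domain assumption. A branch is identified with its set of formulas; it is closed if $\bot$ occurs on it, open otherwise; a rule is applicable to a premise set on a branch if it has not yet been applied to it there; a branch is fully expanded if closed or no rule is applicable (branches may be infinite; rules are applied fairly). -}

module Defs where

open import Data.Nat using (ℕ; _<_; _≡ᵇ_)
open import Data.Bool using (Bool; true; false; if_then_else_; T)
open import Data.List using (List; []; _∷_; map)
open import Data.List.Relation.Unary.All using (All)
open import Data.List.Relation.Unary.Any using (Any)
open import Data.List.Membership.Propositional using (_∈_)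
open import Data.Maybe using (Maybe; just; nothing)
open import Data.Product using (Σ; _×_; _,_)
open import Data.Sum using (_⊎_)
open import Data.Empty using (⊥)
open import Data.Unit using (⊤)
open import Relation.Nullary using (¬_)
open import Relation.Binary.PropositionalEquality using (_≡_; _≢_)
open import Function.Bundles using (_⇔_)

-- Syntax.  Bound variables, parameters and predicate symbols are named
-- by natural numbers.  A predicate applied to a list of terms has the
-- arity given by the length of that list.

mutual
  data Term : Set where
    var : ℕ → Term
    par : ℕ → Term
    ι   : ℕ → Formula → Term

  data Formula : Set where
    pred : ℕ → List Term → Formula
    _≐_  : Term → Term → Formula
    E    : Term → Formula
    ¬'   : Formula → Formula
    _∧'_ : Formula → Formula → Formula
    ∀'   : ℕ → Formula → Formula

infix 8 _≐_
infixr 7 _∧'_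

_≠_ : Term → Term → Formula
t₁ ≠ t₂ = ¬' (t₁ ≐ t₂)

data IsDD : Term → Set where
  isDD : ∀ x φ → IsDD (ι x φ)

mutual
  FreeT : ℕ → Term → Set
  FreeT x (var y)   = x ≡ y
  FreeT x (par a)   = ⊥
  FreeT x (ι y φ)   = (x ≢ y) × FreeF x φ

  FreeTs : ℕ → List Term → Set
  FreeTs x []       = ⊥
  FreeTs x (t ∷ ts) = FreeT x t ⊎ FreeTs x ts

  FreeF : ℕ → Formula → Set
  FreeF x (pred P ts) = FreeTs x ts
  FreeF x (t₁ ≐ t₂)   = FreeT x t₁ ⊎ FreeT x t₂
  FreeF x (E t)       = FreeT x t
  FreeF x (¬' φ)      = FreeF x φ
  FreeF x (φ ∧' ψ)    = FreeF x φ ⊎ FreeF x ψ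
  FreeF x (∀' y φ)    = (x ≢ y) × FreeF x φ

ClosedT : Term → Set
ClosedT t = ∀ x → ¬ FreeT x t

Sentence : Formula → Set
Sentence φ = ∀ x → ¬ FreeF x φ

-- All
-- substituted terms in the calculi (and in the proposition) are closed
-- terms, for which this is exactly correct (capture-free) substitution.

mutual
  substT : ℕ → Term → Term → Term
  substT x s (var y) = if x ≡ᵇ y then s else var y
  substT x s (par a) = par a
  substT x s (ι y φ) = if x ≡ᵇ y then ι y φ else ι y (substF x s φ)

  substTs : ℕ → Term → List Term → List Term
  substTs x s []       = []
  substTs x s (t ∷ ts) = substT x s t ∷ substTs x s ts

  substF : ℕ → Term → Formula → Formula
  substF x s (pred P ts) = pred P (substTs x s ts)
  substF x s (t₁ ≐ t₂)   = substT x s t₁ ≐ substT x s t₂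
  substF x s (E t)       = E (substT x s t)
  substF x s (¬' φ)      = ¬' (substF x s φ)
  substF x s (φ ∧' ψ)    = substF x s φ ∧' substF x s ψ
  substF x s (∀' y φ)    = if x ≡ᵇ y then ∀' y φ else ∀' y (substF x s φ)

_[_/_] : Formula → ℕ → Term → Formula
φ [ x / t ] = substF x t φ

mutual
  OccT : Term → Term → Set
  OccT u (var y) = u ≡ var y
  OccT u (par a) = u ≡ par a
  OccT u (ι y φ) = (u ≡ ι y φ) ⊎ OccF u φ

  OccTs : Term → List Term → Set
  OccTs u []       = ⊥
  OccTs u (t ∷ ts) = OccT u t ⊎ OccTs u ts

  OccF : Term → Formula → Set
  OccF u (pred P ts) = OccTs u ts
  OccF u (t₁ ≐ t₂)   = OccT u t₁ ⊎ OccT u t₂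
  OccF u (E t)       = OccT u t
  OccF u (¬' φ)      = OccF u φ
  OccF u (φ ∧' ψ)    = OccF u φ ⊎ OccF u ψ
  OccF u (∀' y φ)    = OccF u φ

mutual
  EFreeT : Term → Set
  EFreeT (var y) = ⊤
  EFreeT (par a) = ⊤
  EFreeT (ι y φ) = EFreeF φ

  EFreeTs : List Term → Set
  EFreeTs []       = ⊤
  EFreeTs (t ∷ ts) = EFreeT t × EFreeTs ts

  EFreeF : Formula → Set
  EFreeF (pred P ts) = EFreeTs ts
  EFreeF (t₁ ≐ t₂)   = EFreeT t₁ × EFreeT t₂
  EFreeF (E t)       = ⊥
  EFreeF (¬' φ)      = EFreeF φ
  EFreeF (φ ∧' ψ)    = EFreeF φ × EFreeF ψ
  EFreeF (∀' y φ)    = EFreeF φ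

data Logic : Set where
  PFL PQFL NFL NQFL NQFL⁻ : Logic

InLang : Logic → Formula → Set
InLang NQFL⁻ φ = EFreeF φ
InLang _     φ = ⊤

data Node : Set where
  fm : Formula → Node
  ⊥ₙ : Node

BranchSet : Set₁
BranchSet = Node → Set

TermOn : BranchSet → Term → Set
TermOn B t = ClosedT t × Σ Formula (λ φ → B (fm φ) × OccF t φ)

ParOn : BranchSet → ℕ → Set
ParOn B b = TermOn B (par b)

FreshFor : BranchSet → ℕ → Set
FreshFor B a = ¬ Σ Formula (λ φ → B (fm φ) × OccF (par a) φ)

-- Each constructor records the data determining the
-- premise set and all non-fresh choices; the fresh parameter (if the
-- rule has one) is supplied separately when the rule is applied.

data Rule : Set where
  r¬¬E   : Formula → Rule
  r∧E    : Formula → Formula → Rule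
  r¬∧E   : Formula → Formula → Rule
  r⊥₁    : Formula → Rule
  r⊥₂    : Term → Rule
  r⊥₃    : ℕ → Rule
  r∀E₁   : ℕ → Formula → ℕ → Rule
  r¬∀E₁  : ℕ → Formula → Rule
  r∀E₂   : ℕ → Formula → ℕ → Rule
  r¬∀E₂  : ℕ → Formula → Rule
  r=E    : Bool → Term → Term → ℕ → Formula → Rule
  r=I₁   : ℕ → List Term → Term → Rule
  r=I₂   : Term → Term → Term → Rule
  rcut₁  : ℕ → Term → Rule
  rcut₂  : ℕ → Term → Rule
  rEE₁   : Term → Rule
  rEE₂   : Term → Rule
  rEI₁   : ℕ → List Term → Term → Rule
  rEI₂   : Term → Term → Term → Rule
  rEI₃   : ℕ → Rule
  rEI₄   : Rule
  rιE₁   : ℕ → ℕ → Formula → ℕ → Rule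
  r¬ιE₁  : ℕ → ℕ → Formula → Rule
  rιE₂   : ℕ → ℕ → Formula → ℕ → Rule
  r¬ιE₂  : ℕ → ℕ → Formula → Rule

premises : Rule → List Formula
premises (r¬¬E φ)          = ¬' (¬' φ) ∷ []
premises (r∧E φ ψ)         = (φ ∧' ψ) ∷ []
premises (r¬∧E φ ψ)        = ¬' (φ ∧' ψ) ∷ []
premises (r⊥₁ φ)           = φ ∷ ¬' φ ∷ []
premises (r⊥₂ t)           = (t ≠ t) ∷ []
premises (r⊥₃ b)           = (par b ≠ par b) ∷ []
premises (r∀E₁ x φ b)      = ∀' x φ ∷ []
premises (r¬∀E₁ x φ)       = ¬' (∀' x φ) ∷ []
premises (r∀E₂ x φ b)      = ∀' x φ ∷ E (par b) ∷ []
premises (r¬∀E₂ x φ)       = ¬' (∀' x φ) ∷ []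
premises (r=E true t₁ t₂ x φ)  = (t₁ ≐ t₂) ∷ (φ [ x / t₁ ]) ∷ []
premises (r=E false t₁ t₂ x φ) = (t₂ ≐ t₁) ∷ (φ [ x / t₁ ]) ∷ []
premises (r=I₁ P ts t)     = pred P ts ∷ []
premises (r=I₂ t₁ t₂ t)    = (t₁ ≐ t₂) ∷ []
premises (rcut₁ b t)       = []
premises (rcut₂ b t)       = E (par b) ∷ []
premises (rEE₁ t)          = E t ∷ []
premises (rEE₂ t)          = E t ∷ []
premises (rEI₁ P ts t)     = pred P ts ∷ []
premises (rEI₂ t₁ t₂ t)    = (t₁ ≐ t₂) ∷ []
premises (rEI₃ b)          = []
premises rEI₄              = []
premises (rιE₁ b₁ x φ b₂)  = (par b₁ ≐ ι x φ) ∷ []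
premises (r¬ιE₁ b x φ)     = (par b ≠ ι x φ) ∷ []
premises (rιE₂ b₁ x φ b₂)  = (par b₁ ≐ ι x φ) ∷ E (par b₁) ∷ E (par b₂) ∷ []
premises (r¬ιE₂ b x φ)     = (par b ≠ ι x φ) ∷ E (par b) ∷ []

hasFresh : Rule → Bool
hasFresh (r¬∀E₁ _ _)   = true
hasFresh (r¬∀E₂ _ _)   = true
hasFresh (r=I₁ _ _ _)  = true
hasFresh (r=I₂ _ _ _)  = true
hasFresh (rEE₁ _)      = true
hasFresh rEI₄          = true
hasFresh (r¬ιE₁ _ _ _) = true
hasFresh (r¬ιE₂ _ _ _) = true
hasFresh _             = false

conclusions : Rule → ℕ → List (List Node)
conclusions (r¬¬E φ) a         = (fm φ ∷ []) ∷ []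
conclusions (r∧E φ ψ) a        = (fm φ ∷ fm ψ ∷ []) ∷ []
conclusions (r¬∧E φ ψ) a       = (fm (¬' φ) ∷ []) ∷ (fm (¬' ψ) ∷ []) ∷ []
conclusions (r⊥₁ φ) a          = (⊥ₙ ∷ []) ∷ []
conclusions (r⊥₂ t) a          = (⊥ₙ ∷ []) ∷ []
conclusions (r⊥₃ b) a          = (⊥ₙ ∷ []) ∷ []
conclusions (r∀E₁ x φ b) a     = (fm (φ [ x / par b ]) ∷ []) ∷ []
conclusions (r¬∀E₁ x φ) a      = (fm (¬' (φ [ x / par a ])) ∷ []) ∷ []
conclusions (r∀E₂ x φ b) a     = (fm (φ [ x / par b ]) ∷ []) ∷ []
conclusions (r¬∀E₂ x φ) a      = (fm (E (par a)) ∷ fm (¬' (φ [ x / par a ])) ∷ []) ∷ []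
conclusions (r=E o t₁ t₂ x φ) a = (fm (φ [ x / t₂ ]) ∷ []) ∷ []
conclusions (r=I₁ P ts t) a    = (fm (par a ≐ t) ∷ []) ∷ []
conclusions (r=I₂ t₁ t₂ t) a   = (fm (par a ≐ t) ∷ []) ∷ []
conclusions (rcut₁ b t) a      = (fm (par b ≐ t) ∷ []) ∷ (fm (par b ≠ t) ∷ []) ∷ []
conclusions (rcut₂ b t) a      = (fm (par b ≐ t) ∷ []) ∷ (fm (par b ≠ t) ∷ []) ∷ []
conclusions (rEE₁ t) a         = (fm (par a ≐ t) ∷ []) ∷ []
conclusions (rEE₂ t) a         = (fm (t ≐ t) ∷ []) ∷ []
conclusions (rEI₁ P ts t) a    = (fm (E t) ∷ []) ∷ []
conclusions (rEI₂ t₁ t₂ t) a   = (fm (E t) ∷ []) ∷ []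
conclusions (rEI₃ b) a         = (fm (E (par b)) ∷ []) ∷ []
conclusions rEI₄ a             = (fm (E (par a)) ∷ []) ∷ []
conclusions (rιE₁ b₁ x φ b₂) a =
  (fm (φ [ x / par b₁ ]) ∷ fm (¬' (φ [ x / par b₂ ])) ∷ [])
  ∷ (fm (par b₁ ≐ par b₂) ∷ fm (φ [ x / par b₁ ]) ∷ []) ∷ []
conclusions (r¬ιE₁ b x φ) a    =
  (fm (¬' (φ [ x / par b ])) ∷ [])
  ∷ (fm (par a ≠ par b) ∷ fm (φ [ x / par a ]) ∷ []) ∷ []
conclusions (rιE₂ b₁ x φ b₂) a =
  (fm (φ [ x / par b₁ ]) ∷ fm (¬' (φ [ x / par b₂ ])) ∷ [])
  ∷ (fm (par b₁ ≐ par b₂) ∷ fm (φ [ x / par b₁ ]) ∷ []) ∷ []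
conclusions (r¬ιE₂ b x φ) a    =
  (fm (¬' (φ [ x / par b ])) ∷ [])
  ∷ (fm (par a ≠ par b) ∷ fm (φ [ x / par a ]) ∷ fm (E (par a)) ∷ []) ∷ []

NFLonlyDD : Logic → Term → Set
NFLonlyDD NFL t = IsDD t
NFLonlyDD _   t = ⊤

SideOK : Logic → Rule → BranchSet → Set
SideOK L (r¬¬E φ) B          = ⊤
SideOK L (r∧E φ ψ) B         = ⊤
SideOK L (r¬∧E φ ψ) B        = ⊤
SideOK L (r⊥₁ φ) B           = ⊤
SideOK L (r⊥₂ t) B           = TermOn B t
SideOK L (r⊥₃ b) B           = ParOn B b
SideOK L (r∀E₁ x φ b) B      = ParOn B b
SideOK L (r¬∀E₁ x φ) B       = ⊤
SideOK L (r∀E₂ x φ b) B      = ParOn B b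
SideOK L (r¬∀E₂ x φ) B       = ⊤
SideOK L (r=E o t₁ t₂ x φ) B = TermOn B t₁ × TermOn B t₂
SideOK L (r=I₁ P ts t) B     = (t ∈ ts) × IsDD t
SideOK L (r=I₂ t₁ t₂ t) B    = ((t ≡ t₁) ⊎ (t ≡ t₂)) × IsDD t
SideOK L (rcut₁ b t) B       = ParOn B b × TermOn B t × IsDD t
SideOK L (rcut₂ b t) B       = ParOn B b × TermOn B t × IsDD t
SideOK L (rEE₁ t) B          = TermOn B t × IsDD t
SideOK L (rEE₂ t) B          = TermOn B t
SideOK L (rEI₁ P ts t) B     = (t ∈ ts) × NFLonlyDD L t
SideOK L (rEI₂ t₁ t₂ t) B    = ((t ≡ t₁) ⊎ (t ≡ t₂)) × NFLonlyDD L t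
SideOK L (rEI₃ b) B          = ParOn B b
SideOK L rEI₄ B              = ∀ b → ¬ ParOn B b
SideOK L (rιE₁ b₁ x φ b₂) B  = ParOn B b₁ × ParOn B b₂
SideOK L (r¬ιE₁ b x φ) B     = ParOn B b
SideOK L (rιE₂ b₁ x φ b₂) B  = ParOn B b₁ × ParOn B b₂
SideOK L (r¬ιE₂ b x φ) B     = ParOn B b

-- The calculi TC_L.  The Bool 'ned' switches on the non-empty domain
-- assumption, which adds (EI₄) to TC_PFL and TC_NFL.

data RuleName : Set where
  n¬¬E n∧E n¬∧E n⊥₁ n⊥₂ n⊥₃ n∀E₁ n¬∀E₁ n∀E₂ n¬∀E₂ n=E n=I₁ n=I₂
    ncut₁ ncut₂ nEE₁ nEE₂ nEI₁ nEI₂ nEI₃ nEI₄ nιE₁ n¬ιE₁ nιE₂ n¬ιE₂ : RuleName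

nameOf : Rule → RuleName
nameOf (r¬¬E _)        = n¬¬E
nameOf (r∧E _ _)       = n∧E
nameOf (r¬∧E _ _)      = n¬∧E
nameOf (r⊥₁ _)         = n⊥₁
nameOf (r⊥₂ _)         = n⊥₂
nameOf (r⊥₃ _)         = n⊥₃
nameOf (r∀E₁ _ _ _)    = n∀E₁
nameOf (r¬∀E₁ _ _)     = n¬∀E₁
nameOf (r∀E₂ _ _ _)    = n∀E₂
nameOf (r¬∀E₂ _ _)     = n¬∀E₂
nameOf (r=E _ _ _ _ _) = n=E
nameOf (r=I₁ _ _ _)    = n=I₁
nameOf (r=I₂ _ _ _)    = n=I₂
nameOf (rcut₁ _ _)     = ncut₁
nameOf (rcut₂ _ _)     = ncut₂
nameOf (rEE₁ _)        = nEE₁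
nameOf (rEE₂ _)        = nEE₂
nameOf (rEI₁ _ _ _)    = nEI₁
nameOf (rEI₂ _ _ _)    = nEI₂
nameOf (rEI₃ _)        = nEI₃
nameOf rEI₄            = nEI₄
nameOf (rιE₁ _ _ _ _)  = nιE₁
nameOf (r¬ιE₁ _ _ _)   = n¬ιE₁
nameOf (rιE₂ _ _ _ _)  = nιE₂
nameOf (r¬ιE₂ _ _ _)   = n¬ιE₂

inCalc : Logic → Bool → RuleName → Bool
inCalc L ned n¬¬E = true
inCalc L ned n∧E  = true
inCalc L ned n¬∧E = true
inCalc L ned n⊥₁  = true
inCalc L ned n=E  = true
inCalc PFL ned n⊥₂   = true
inCalc PFL ned n∀E₂  = true
inCalc PFL ned n¬∀E₂ = true
inCalc PFL ned ncut₂ = true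
inCalc PFL ned nEE₁  = true
inCalc PFL ned nιE₂  = true
inCalc PFL ned n¬ιE₂ = true
inCalc PFL ned nEI₄  = ned
inCalc PQFL ned n⊥₂   = true
inCalc PQFL ned n∀E₁  = true
inCalc PQFL ned n¬∀E₁ = true
inCalc PQFL ned ncut₂ = true
inCalc PQFL ned nEE₁  = true
inCalc PQFL ned nEI₃  = true
inCalc PQFL ned nιE₁  = true
inCalc PQFL ned n¬ιE₁ = true
inCalc NFL ned nEE₂  = true
inCalc NFL ned n∀E₂  = true
inCalc NFL ned n¬∀E₂ = true
inCalc NFL ned ncut₂ = true
inCalc NFL ned nEE₁  = true
inCalc NFL ned nEI₁  = true
inCalc NFL ned nEI₂  = true
inCalc NFL ned nιE₂  = true
inCalc NFL ned n¬ιE₂ = true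
inCalc NFL ned nEI₄  = ned
inCalc NQFL ned n⊥₃   = true
inCalc NQFL ned n∀E₁  = true
inCalc NQFL ned n¬∀E₁ = true
inCalc NQFL ned ncut₂ = true
inCalc NQFL ned nEE₁  = true
inCalc NQFL ned nEI₁  = true
inCalc NQFL ned nEI₂  = true
inCalc NQFL ned nEI₃  = true
inCalc NQFL ned nιE₁  = true
inCalc NQFL ned n¬ιE₁ = true
inCalc NQFL⁻ ned n⊥₃   = true
inCalc NQFL⁻ ned n∀E₁  = true
inCalc NQFL⁻ ned n¬∀E₁ = true
inCalc NQFL⁻ ned ncut₁ = true
inCalc NQFL⁻ ned n=I₁  = true
inCalc NQFL⁻ ned n=I₂  = true
inCalc NQFL⁻ ned nιE₁  = true
inCalc NQFL⁻ ned n¬ιE₁ = true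
inCalc L ned _ = false

Allowed : Logic → Bool → Rule → Set
Allowed L ned r = T (inCalc L ned (nameOf r))

-- A branch is generated in stages from the
-- initial set Γ: at each stage either nothing happens, or one rule of
-- TC_L not yet applied to its premise set is applied (premises and side
-- conditions holding at that stage, the fresh parameter not occurring on
-- the branch so far) and the branch is extended by one alternative of
-- its conclusions.

Step : Set
Step = Rule × ℕ × List Node      -- rule instance, fresh parameter, chosen alternative

StepOK : Logic → Bool → (ℕ → BranchSet) → (ℕ → Maybe Step) → ℕ → Set
StepOK L ned S st n with st n
... | nothing = ∀ N → S (Data.Nat.suc n) N ⇔ S n N
... | just (r , a , alt) =
      Allowed L ned r
    × All (λ φ → S n (fm φ)) (premises r)
    × SideOK L r (S n)
    × (hasFresh r ≡ true → FreshFor (S n) a)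
    × (∀ m → m < n → ∀ a' alt' → st m ≢ just (r , a' , alt'))
    × (alt ∈ conclusions r a)
    × (∀ N → S (Data.Nat.suc n) N ⇔ (S n N ⊎ N ∈ alt))

record TBranch (L : Logic) (ned : Bool) (Γ : List Formula) : Set₁ where
  field
    stage : ℕ → BranchSet
    step  : ℕ → Maybe Step
    init  : ∀ N → stage 0 N ⇔ (N ∈ map fm Γ)
    grow  : ∀ n → StepOK L ned stage step n

  set : BranchSet
  set N = Σ ℕ (λ n → stage n N)

  Closed : Set
  Closed = set ⊥ₙ

  Open : Set
  Open = ¬ Closed

  Applied : Rule → Set
  Applied r = Σ ℕ (λ n → Σ ℕ (λ a → Σ (List Node) (λ alt → step n ≡ just (r , a , alt))))

  FullyExpanded : Set
  FullyExpanded = Closed ⊎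
    (∀ r → Allowed L ned r → All (λ φ → set (fm φ)) (premises r)
         → SideOK L r set → Applied r)

  _∼_ : Term → Term → Set
  t₁ ∼ t₂ = set (fm (t₁ ≐ t₂)) ⊎ (t₁ ≡ t₂)

{-# OPTIONS --safe #-}
-- (=E) belongs to every calculus TC_L and its side conditions only ask for t₁ and t₂ to be
-- on the branch, so on an open, fully expanded branch every instance of it has been applied,
-- and the sole conclusion φ[x/t₂] has been added.
module Submission where

open import Defs
open import Data.Nat using (ℕ; suc)
open import Data.Bool using (Bool; true; false)
open import Data.List using (List; []; _∷_)
open import Data.List.Membership.Propositional using (_∈_)
open import Data.List.Relation.Unary.All using (All; []; _∷_)
open import Data.List.Relation.Unary.Any using (here)
open import Data.Maybe using (Maybe; just)
open import Data.Product using (_,_)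
open import Data.Sum using (inj₁; inj₂)
open import Data.Empty using (⊥-elim)
open import Data.Unit using (tt)
open import Relation.Binary.PropositionalEquality using (_≡_; refl)
open import Function.Bundles using (_⇔_; mk⇔; Equivalence)

chosen-∈-conclusions : ∀ {L ned} {S : ℕ → BranchSet} {st : ℕ → Maybe Step} {n r a alt}
  → st n ≡ just (r , a , alt) → StepOK L ned S st n → alt ∈ conclusions r a
chosen-∈-conclusions {st = st} {n} st-n≡ ok with st n
chosen-∈-conclusions refl (_ , _ , _ , _ , _ , alt∈ , _) | just _ = alt∈

chosen-⊆-next-stage : ∀ {L ned} {S : ℕ → BranchSet} {st : ℕ → Maybe Step} {n r a alt N}
  → st n ≡ just (r , a , alt) → StepOK L ned S st n → N ∈ alt → S (suc n) N
chosen-⊆-next-stage {st = st} {n} st-n≡ ok N∈alt with st n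
chosen-⊆-next-stage {N = N} refl (_ , _ , _ , _ , _ , _ , extend) N∈alt | just _ =
  Equivalence.from (extend N) (inj₂ N∈alt)

module _ {L ned Γ} (𝓑 : TBranch L ned Γ) (open-𝓑 : TBranch.Open 𝓑) where
  open TBranch 𝓑

  expanded⇒applied : FullyExpanded
    → ∀ r → Allowed L ned r → All (λ φ → set (fm φ)) (premises r) → SideOK L r set → Applied r
  expanded⇒applied (inj₁ closed) _ _ _ _ = ⊥-elim (open-𝓑 closed)
  expanded⇒applied (inj₂ saturated)      = saturated

  sole-conclusion-on-branch : ∀ {r ψ} → (∀ a → conclusions r a ≡ (fm ψ ∷ []) ∷ [])
    → Applied r → set (fm ψ)
  sole-conclusion-on-branch sole (n , a , alt , step-n≡)
    with chosen-∈-conclusions step-n≡ (grow n)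
  ... | alt∈ rewrite sole a with alt∈
  ... | here refl = suc n , chosen-⊆-next-stage step-n≡ (grow n) (here refl)

  =E-closed : FullyExpanded → ∀ o {t₁ t₂} x φ
    → All (λ χ → set (fm χ)) (premises (r=E o t₁ t₂ x φ))
    → TermOn set t₁ → TermOn set t₂ → set (fm (φ [ x / t₂ ]))
  =E-closed expanded o x φ prems t₁-on t₂-on =
    sole-conclusion-on-branch (λ _ → refl)
      (expanded⇒applied expanded (r=E o _ _ x φ) tt prems (t₁-on , t₂-on))

proposition2 : (L : Logic) (ned : Bool) (Γ : List Formula)
    → All Sentence Γ → All (InLang L) Γ
    → (𝓑 : TBranch L ned Γ)
    → TBranch.Open 𝓑 → TBranch.FullyExpanded 𝓑
    → (t₁ t₂ : Term)
    → TermOn (TBranch.set 𝓑) t₁ → TermOn (TBranch.set 𝓑) t₂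
    → TBranch._∼_ 𝓑 t₁ t₂
    → (x : ℕ) (φ : Formula) → InLang L φ
    → (TBranch.set 𝓑 (fm (φ [ x / t₁ ])) ⇔ TBranch.set 𝓑 (fm (φ [ x / t₂ ])))
proposition2 L ned Γ _ _ 𝓑 open-𝓑 expanded t₁ t₂ t₁-on t₂-on (inj₁ t₁≐t₂) x φ _ =
  mk⇔ (λ φ[t₁] → =E-closed 𝓑 open-𝓑 expanded true  x φ (t₁≐t₂ ∷ φ[t₁] ∷ []) t₁-on t₂-on)
      -- the reversed orientation of (=E) takes t₁ = t₂ as premise to rewrite t₂ into t₁
      (λ φ[t₂] → =E-closed 𝓑 open-𝓑 expanded false x φ (t₁≐t₂ ∷ φ[t₂] ∷ []) t₂-on t₁-on)
proposition2 L ned Γ _ _ 𝓑 _ _ t₁ t₂ _ _ (inj₂ refl) x φ _ = mk⇔ (λ p → p) (λ p → p)
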